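{- Let $j\in\{1,\ldots,k\}$ and let $S\in\Omega_{j-1}$ be normalized. Let $e(S)=\{X\in\Omega_j:X\,e\,S\}$. Then the orbits of $\mathrm{Aut}(S)$ on $e(S)$ (under the action on partial assignments) are in one-to-one correspondence with the orbits of $\mathrm{Aut}(S)$ on $u_j^{\mathrm{Aut}(U_{j-1})}\times R$ (under the action on $U\times R$).
   Context: Let $U$, $R$ be finite sets. Permutations act on the right and $\pi_1\pi_2$ means first $\pi_1$ then $\pi_2$. The wreath product $\mathrm{Sym}(R)\wr\mathrm{Sym}(U)$ consists of pairs $(\pi,\sigma)$ with $\pi\in\mathrm{Sym}(U)$, $\sigma:U\to\mathrm{Sym}(R)$, with product $(\pi_1,\sigma_1)(\pi_2,\sigma_2)=(\pi_1\pi_2,\sigma)$, $\sigma(u)=\sigma_1(u^{\pi_2^{ -1}})\sigma_2(u)$. Let $\Gamma\le\mathrm{Sym}(R)\wr\mathrm{Sym}(U)$. $\gamma=(\pi,\sigma)$ acts on $u\in U$ by $u^\gamma=u^\pi$, on subsets of $U$ elementwise, on $(u,r)\in U\times R$ by $(u,r)^\gamma=(u^\pi,r^{\sigma(u^\pi)})$, and on partial assignments $X:W\to R$ ($W\subseteq U$) by $X^\gamma:W^\pi\to R$, $X^\gamma(u)=X(u^{\pi^{ -1}})^{\sigma(u)}$. Write $\underline{X}=W$, and $X|_Q$ for restriction. For an object $Y$ acted on by $\Gamma$, $\mathrm{Aut}(Y)=\{\gamma\in\Gamma:Y^\gamma=Y\}$, and $Y^\Lambda=\{Y^\lambda:\lambda\in\Lambda\}$.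 Fix distinct $u_1,\ldots,u_k\in U$, $U_j=\{u_1,\ldots,u_j\}$ ($U_0=\emptyset$). $\Omega_j$ is the set of partial assignments $X$ with $\underline{X}=U_j^\gamma$ for some $\gamma\in\Gamma$; $X\in\Omega_j$ is normalized if $\underline{X}=U_j$. For $X\in\Omega_j$, $S\in\Omega_{j-1}$, $X\,e\,S$ iff there exists $\gamma\in\Gamma$ with $\underline{X}^\gamma=U_j$, $\underline{S}^\gamma=U_{j-1}$, and $X^\gamma|_{U_{j-1}}=S^\gamma$. For normalized $S$ one has $\mathrm{Aut}(S)\le\mathrm{Aut}(U_{j-1})$. -}

module Defs where

open import Data.Nat using (ℕ; suc; _<_)
open import Data.Fin using (Fin; toℕ)
open import Data.Fin.Permutation using (Permutation′; _⟨$⟩ʳ_; _⟨$⟩ˡ_; _∘ₚ_; flip)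
  renaming (id to idₚ)
open import Data.Maybe using (Maybe; just; nothing; map; Is-just)
open import Data.Product using (Σ; ∃; ∃-syntax; _×_; _,_)
open import Function.Bundles using (_⇔_)
open import Function.Definitions using (Injective)
open import Relation.Binary.PropositionalEquality using (_≡_)
open import Relation.Nullary using (¬_)

-- U = Fin n, R = Fin m.  Sym(X) = Permutation′ X (stdlib).  Right actions:
-- u^π = π ⟨$⟩ʳ u ; stdlib's  π₁ ∘ₚ π₂  is "first π₁ then π₂", matching π₁π₂.

-- Elements (π , σ) of the wreath product Sym(R) ≀ Sym(U).
record Wr (n m : ℕ) : Set where
  constructor ⟨_,_⟩
  field
    π : Permutation′ n
    σ : Fin n → Permutation′ m
open Wr public

module _ {n m : ℕ} where

  _·_ : Wr n m → Wr n m → Wr n m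
  ⟨ π₁ , σ₁ ⟩ · ⟨ π₂ , σ₂ ⟩ = ⟨ π₁ ∘ₚ π₂ , (λ u → σ₁ (π₂ ⟨$⟩ˡ u) ∘ₚ σ₂ u) ⟩

  e₁ : Wr n m
  e₁ = ⟨ idₚ , (λ _ → idₚ) ⟩

  inv : Wr n m → Wr n m
  inv ⟨ π₀ , σ₀ ⟩ = ⟨ flip π₀ , (λ u → flip (σ₀ (π₀ ⟨$⟩ʳ u))) ⟩

record Subgroup (n m : ℕ) : Set₁ where
  field
    mem : Wr n m → Set
    e∈Γ     : mem e₁
    ·-closed : ∀ {g h} → mem g → mem h → mem (g · h)
    inv-closed : ∀ {g} → mem g → mem (inv g)
open Subgroup public

SubU : ℕ → Set₁
SubU n = Fin n → Set

_≐_ : {n : ℕ} → SubU n → SubU n → Set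
P ≐ Q = ∀ x → P x ⇔ Q x

module _ {n m : ℕ} where

  -- partial assignments X : W → R, W ⊆ U
  PA : Set
  PA = Fin n → Maybe (Fin m)

  dom : PA → SubU n
  dom X u = Is-just (X u)

  actU : Fin n → Wr n m → Fin n
  actU u γ = π γ ⟨$⟩ʳ u

  actSub : SubU n → Wr n m → SubU n
  actSub W γ u = W (π γ ⟨$⟩ˡ u)

  actUR : Fin n × Fin m → Wr n m → Fin n × Fin m
  actUR (u , r) γ = (π γ ⟨$⟩ʳ u , σ γ (π γ ⟨$⟩ʳ u) ⟨$⟩ʳ r)

  actPA : PA → Wr n m → PA
  actPA X γ u = map (σ γ u ⟨$⟩ʳ_) (X (π γ ⟨$⟩ˡ u))

  _≗ₚ_ : PA → PA → Set
  X ≗ₚ Y = ∀ u → X u ≡ Y u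

  RestrictEq : PA → SubU n → PA → Set
  RestrictEq X Q Y = ∀ u → (Q u → X u ≡ Y u) × (¬ Q u → Y u ≡ nothing)

-- Setting: Γ ≤ Sym(Fin m) ≀ Sym(Fin n), and u : Fin k → Fin n injective
-- (u₁,…,u_k distinct; paper's u_{i+1} is  u i).
module Setting {n m k : ℕ} (Γ : Subgroup n m) (u : Fin k → Fin n) where

  Uset : ℕ → SubU n
  Uset i x = ∃[ l ] (toℕ l < i × u l ≡ x)

  Ω : ℕ → PA {n} {m} → Set
  Ω i X = ∃[ γ ] (mem Γ γ × dom X ≐ actSub (Uset i) γ)

  Normalized : ℕ → PA {n} {m} → Set
  Normalized i X = dom X ≐ Uset i

  -- X e S  for X ∈ Ω_{i+1}, S ∈ Ω_i  (i = j-1 in the paper's notation)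
  E : ℕ → PA {n} {m} → PA {n} {m} → Set
  E i X S = ∃[ γ ] (mem Γ γ
                    × dom (actPA X γ) ≐ Uset (suc i)
                    × dom (actPA S γ) ≐ Uset i
                    × RestrictEq (actPA X γ) (Uset i) (actPA S γ))

  AutPA : PA {n} {m} → Wr n m → Set
  AutPA S γ = mem Γ γ × actPA S γ ≗ₚ S

  AutSub : SubU n → Wr n m → Set
  AutSub W γ = mem Γ γ × actSub W γ ≐ W

  eSet : ℕ → PA {n} {m} → Set
  eSet i S = Σ (PA {n} {m}) (λ X → Ω (suc i) X × E i X S)

  -- u_{i+1}^{Aut(U_i)} × R   (here  l : Fin k  stands for u_{l+1}, i = toℕ l)
  OrbTimesR : Fin k → Set
  OrbTimesR l = Σ (Fin n × Fin m) (λ { (v , r) → ∃[ γ ] (AutSub (Uset (toℕ l)) γ × actU (u l) γ ≡ v) })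

module _ {n m : ℕ} where
  OrbRelPA : (Wr n m → Set) → PA {n} {m} → PA {n} {m} → Set
  OrbRelPA Λ X Y = ∃[ γ ] (Λ γ × actPA X γ ≗ₚ Y)

  OrbRelUR : (Wr n m → Set) → Fin n × Fin m → Fin n × Fin m → Set
  OrbRelUR Λ p q = ∃[ γ ] (Λ γ × actUR p γ ≡ q)

-- A one-to-one correspondence between the classes of  ~A  and of  ~B
-- (a bijection between the quotient sets, presented via representatives):
-- f is well defined and injective on classes, and surjective on classes.
ClassBijection : {A B : Set} → (A → A → Set) → (B → B → Set) → Set
ClassBijection {A} {B} _~A_ _~B_ =
  Σ (A → B) (λ f → (∀ a a′ → (a ~A a′) ⇔ (f a ~B f a′))
                 × (∀ b → ∃[ a ] (f a ~B b)))

module Submission where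

-- Every X ∈ e(S) is S extended by exactly one new point (v , r): after
-- normalising by a witness γ of  X e S,  X^γ is S^γ plus the point (u_j , r₀)
-- (X^γ lives on U_j = U_{j-1} ∪ {u_j} and restricts to S^γ on U_{j-1}), and
-- pulling back by γ⁻¹ gives the point (v , r) = (u_j , r₀)^{γ⁻¹}, where γ⁻¹
-- stabilises U_{j-1} = dom S.  Conversely, S extended by any point of
-- u_j^{Aut(U_{j-1})} × R lies in e(S).  Single-point extensions are
-- equivariant, determined by their point, and (when the point is outside
-- dom S) determine their point; so X ↦ (new point of X) is the required
-- bijection between orbits.

open import Defs
open import Data.Nat using (ℕ; suc; _<_; s≤s⁻¹)
open import Data.Nat.Properties using (_<?_; ≤∧≮⇒≡; <-irrefl; m<n⇒m<1+n; n<1+n)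
open import Data.Fin using (Fin; toℕ)
open import Data.Fin.Properties using (toℕ-injective; _≟_)
open import Data.Fin.Permutation using (Permutation′; _⟨$⟩ʳ_; _⟨$⟩ˡ_; inverseˡ; inverseʳ)
open import Data.Maybe using (Maybe; just; nothing; map; Is-just)
open import Data.Maybe.Relation.Unary.Any using (just)
open import Data.Maybe.Properties using (map-id; map-∘; map-cong; just-injective)
open import Data.Product using (Σ; _×_; proj₁; proj₂; _,_; ∃-syntax)
open import Data.Sum using (_⊎_; inj₁; inj₂; [_,_])
open import Data.Sum.Function.Propositional using (_⊎-⇔_)
open import Data.Unit using (tt)
open import Data.Empty using (⊥-elim)
open import Function using (id; _∘_)
open import Function.Bundles using (_⇔_; mk⇔; Equivalence)
open import Function.Definitions using (Injective)
import Function.Properties.Equivalence as ⇔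
open import Relation.Binary.PropositionalEquality
  using (_≡_; _≢_; refl; sym; trans; cong; subst; module ≡-Reasoning)
open import Relation.Nullary using (¬_; yes; no)

open Equivalence using (to; from)

is-just-value : {A : Set} (x : Maybe A) → Is-just x → ∃[ a ] x ≡ just a
is-just-value (just a) _ = a , refl

not-just : {A : Set} (x : Maybe A) → ¬ Is-just x → x ≡ nothing
not-just (just _) undefined = ⊥-elim (undefined (just tt))
not-just nothing  _         = refl

is-just-map : {A B : Set} (f : A → B) (x : Maybe A) → Is-just (map f x) ⇔ Is-just x
is-just-map f (just _) = mk⇔ (λ _ → just tt) (λ _ → just tt)
is-just-map f nothing  = mk⇔ (λ ()) (λ ())

agree-when-defined : {A : Set} (x y : Maybe A)
  → (Is-just x → x ≡ y) → (Is-just y → x ≡ y) → x ≡ y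
agree-when-defined (just _) _        byX _   = byX (just tt)
agree-when-defined nothing  (just _) _   byY = byY (just tt)
agree-when-defined nothing  nothing  _   _   = refl

perm-adjoint : {n : ℕ} (π : Permutation′ n) {v w : Fin n}
  → (π ⟨$⟩ˡ w ≡ v) ⇔ (w ≡ π ⟨$⟩ʳ v)
perm-adjoint π {v} {w} = mk⇔
  (λ eq → trans (sym (inverseʳ π)) (cong (π ⟨$⟩ʳ_) eq))
  (λ eq → trans (cong (π ⟨$⟩ˡ_) eq) (inverseˡ π))

module _ {n : ℕ} where

  ≐-sym : {P Q : SubU n} → P ≐ Q → Q ≐ P
  ≐-sym P≐Q x = ⇔.sym (P≐Q x)

  ≐-trans : {P Q R : SubU n} → P ≐ Q → Q ≐ R → P ≐ R
  ≐-trans P≐Q Q≐R x = ⇔.trans (P≐Q x) (Q≐R x)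

  subst-⇔ : (W : SubU n) {x y : Fin n} → x ≡ y → W x ⇔ W y
  subst-⇔ W refl = mk⇔ id id

  Insert : SubU n → Fin n → SubU n
  Insert Q v w = Q w ⊎ w ≡ v

  Insert-cong : {P Q : SubU n} {v v′ : Fin n} → P ≐ Q → v ≡ v′ → Insert P v ≐ Insert Q v′
  Insert-cong P≐Q refl w = P≐Q w ⊎-⇔ mk⇔ id id

  module _ {m : ℕ} where

    actSub-cong : {P Q : SubU n} (γ : Wr n m) → P ≐ Q → actSub P γ ≐ actSub Q γ
    actSub-cong γ P≐Q w = P≐Q (π γ ⟨$⟩ˡ w)

    actSub-Insert : (Q : SubU n) (v : Fin n) (γ : Wr n m)
      → actSub (Insert Q v) γ ≐ Insert (actSub Q γ) (π γ ⟨$⟩ʳ v)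
    actSub-Insert Q v γ w = mk⇔ id id ⊎-⇔ perm-adjoint (π γ)

    stable-image : {W : SubU n} (γ : Wr n m) → actSub W γ ≐ W
      → ∀ x → W (π γ ⟨$⟩ʳ x) ⇔ W x
    stable-image {W} γ stable x =
      ⇔.trans (⇔.sym (stable (π γ ⟨$⟩ʳ x))) (subst-⇔ W (inverseˡ (π γ)))

    stable-inv : {W : SubU n} (γ : Wr n m) → actSub W γ ≐ W → actSub W (inv γ) ≐ W
    stable-inv = stable-image

    dom-actPA : (X : PA {n} {m}) (γ : Wr n m) → dom (actPA X γ) ≐ actSub (dom X) γ
    dom-actPA X γ w = is-just-map _ (X (π γ ⟨$⟩ˡ w))

    actPA-inv : (X : PA {n} {m}) (γ : Wr n m) → actPA (actPA X γ) (inv γ) ≗ₚ X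
    actPA-inv X γ w = begin
        map (τ ⟨$⟩ˡ_) (map (τ ⟨$⟩ʳ_) x)  ≡⟨ sym (map-∘ x) ⟩
        map ((τ ⟨$⟩ˡ_) ∘ (τ ⟨$⟩ʳ_)) x
          ≡⟨ map-cong {f = (τ ⟨$⟩ˡ_) ∘ (τ ⟨$⟩ʳ_)} {g = id} (λ _ → inverseˡ τ) x ⟩
        map id x                        ≡⟨ map-id x ⟩
        X (π γ ⟨$⟩ˡ (π γ ⟨$⟩ʳ w))       ≡⟨ cong X (inverseˡ (π γ)) ⟩
        X w                             ∎
      where
        open ≡-Reasoning
        τ : Permutation′ m
        τ = σ γ (π γ ⟨$⟩ʳ w)
        x : Maybe (Fin m)
        x = X (π γ ⟨$⟩ˡ (π γ ⟨$⟩ʳ w))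

    record Extends (S : PA {n} {m}) (p : Fin n × Fin m) (X : PA {n} {m}) : Set where
      field
        at-point  : X (proj₁ p) ≡ just (proj₂ p)
        elsewhere : ∀ w → w ≢ proj₁ p → X w ≡ S w
    open Extends

    Extends-resp : {S S′ X X′ : PA {n} {m}} {p : Fin n × Fin m}
      → S ≗ₚ S′ → X ≗ₚ X′ → Extends S p X → Extends S′ p X′
    Extends-resp {p = v , _} S≗S′ X≗X′ ext = record
      { at-point  = trans (sym (X≗X′ v)) (at-point ext)
      ; elsewhere = λ w w≢v → trans (sym (X≗X′ w)) (trans (elsewhere ext w w≢v) (S≗S′ w))
      }

    Extends-act : {S X : PA {n} {m}} {p : Fin n × Fin m} (γ : Wr n m)
      → Extends S p X → Extends (actPA S γ) (actUR p γ) (actPA X γ)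
    Extends-act {S} {X} {v , r} γ ext = record
      { at-point  = trans (cong (map (σ γ (π γ ⟨$⟩ʳ v) ⟨$⟩ʳ_) ∘ X) (inverseˡ (π γ)))
                          (cong (map (σ γ (π γ ⟨$⟩ʳ v) ⟨$⟩ʳ_)) (at-point ext))
      ; elsewhere = λ w w≢vγ → cong (map (σ γ w ⟨$⟩ʳ_))
                       (elsewhere ext _ (w≢vγ ∘ to (perm-adjoint (π γ))))
      }

    Extends-unique : {S X X′ : PA {n} {m}} {p : Fin n × Fin m}
      → Extends S p X → Extends S p X′ → X ≗ₚ X′
    Extends-unique {p = v , _} ext ext′ w with w ≟ v
    ... | yes refl = trans (at-point ext) (sym (at-point ext′))
    ... | no  w≢v  = trans (elsewhere ext w w≢v) (sym (elsewhere ext′ w w≢v))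

    Extends-point-unique : {S X : PA {n} {m}} {p p′ : Fin n × Fin m}
      → S (proj₁ p′) ≡ nothing → Extends S p X → Extends S p′ X → p ≡ p′
    Extends-point-unique {p = v , r} {v′ , r′} fresh ext ext′ with v ≟ v′
    ... | yes refl = cong (v ,_) (just-injective (trans (sym (at-point ext)) (at-point ext′)))
    ... | no  v≢v′ with () ← trans (sym (at-point ext′))
                                   (trans (elsewhere ext v′ (v≢v′ ∘ sym)) fresh)

    insertAt : PA {n} {m} → Fin n × Fin m → PA {n} {m}
    insertAt S (v , r) w with w ≟ v
    ... | yes _ = just r
    ... | no  _ = S w

    insertAt-extends : (S : PA {n} {m}) (p : Fin n × Fin m) → Extends S p (insertAt S p)
    insertAt-extends S (v , r) = record { at-point = at ; elsewhere = off }
      where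
        at : insertAt S (v , r) v ≡ just r
        at with v ≟ v
        ... | yes _   = refl
        ... | no  v≢v = ⊥-elim (v≢v refl)
        off : ∀ w → w ≢ v → insertAt S (v , r) w ≡ S w
        off w w≢v with w ≟ v
        ... | yes w≡v = ⊥-elim (w≢v w≡v)
        ... | no  _   = refl

    Extends-dom : {S X : PA {n} {m}} {p : Fin n × Fin m}
      → Extends S p X → dom X ≐ Insert (dom S) (proj₁ p)
    Extends-dom {S} {X} {v , r} ext w with w ≟ v
    ... | yes refl = mk⇔ (λ _ → inj₂ refl) (λ _ → subst Is-just (sym (at-point ext)) (just tt))
    ... | no  w≢v  = mk⇔ (inj₁ ∘ subst Is-just (elsewhere ext w w≢v))
                         [ subst Is-just (sym (elsewhere ext w w≢v)) , ⊥-elim ∘ w≢v ]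

    module _ {Q : SubU n} {T : PA {n} {m}} (domT : dom T ≐ Q) {v : Fin n} (v∉Q : ¬ Q v) where

      extends⇒restricts : {Y : PA {n} {m}} {r : Fin m} → Extends T (v , r) Y → RestrictEq Y Q T
      extends⇒restricts ext w =
          (λ w∈Q → elsewhere ext w (λ w≡v → v∉Q (subst Q w≡v w∈Q)))
        , (λ w∉Q → not-just (T w) (w∉Q ∘ to (domT w)))

      restricts⇒extends : {Y : PA {n} {m}} → dom Y ≐ Insert Q v → RestrictEq Y Q T
        → ∃[ r ] Extends T (v , r) Y
      restricts⇒extends {Y} domY res =
        let (r , Yv≡r) = is-just-value (Y v) (from (domY v) (inj₂ refl))
        in r , record { at-point = Yv≡r ; elsewhere = off }
        where
          off : ∀ w → w ≢ v → Y w ≡ T w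
          off w w≢v = agree-when-defined (Y w) (T w)
            (λ defY → [ proj₁ (res w) , ⊥-elim ∘ w≢v ] (to (domY w) defY))
            (λ defT → proj₁ (res w) (to (domT w) defT))

-- For a normalised S ∈ Ω_{j-1}: e(S) consists exactly of the extensions of S
-- by the points of u_j^{Aut(U_{j-1})} × R.  (Here i = toℕ j plays j-1.)
module Correspondence {n m k : ℕ} (Γ : Subgroup n m) (u : Fin k → Fin n)
                      (u-inj : Injective _≡_ _≡_ u) (j : Fin k)
                      (S : PA {n} {m}) (normS : Setting.Normalized Γ u (toℕ j) S) where
  open Setting Γ u

  i : ℕ
  i = toℕ j

  Uset-suc : Uset (suc i) ≐ Insert (Uset i) (u j)
  Uset-suc y = mk⇔ split (λ { (inj₁ (l , l<i , ul≡y)) → l , m<n⇒m<1+n l<i , ul≡y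
                            ; (inj₂ refl)           → j , n<1+n i , refl })
    where
      split : Uset (suc i) y → Insert (Uset i) (u j) y
      split (l , l<1+i , ul≡y) with toℕ l <? i
      ... | yes l<i = inj₁ (l , l<i , ul≡y)
      ... | no  l≮i = inj₂ (trans (sym ul≡y)
                                  (cong u (toℕ-injective (≤∧≮⇒≡ (s≤s⁻¹ l<1+i) l≮i))))

  uj∉Ui : ¬ Uset i (u j)
  uj∉Ui (l , l<i , ul≡uj) = <-irrefl refl (subst (λ z → toℕ z < i) (u-inj ul≡uj) l<i)

  point-fresh : (p : OrbTimesR j) → S (proj₁ (proj₁ p)) ≡ nothing
  point-fresh (_ , δ , (_ , δ-stable) , refl) =
    not-just _ (uj∉Ui ∘ to (stable-image δ δ-stable (u j)) ∘ to (normS _))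

  e⇒point : (X : eSet i S) → Σ (OrbTimesR j) (λ p → Extends S (proj₁ p) (proj₁ X))
  e⇒point (X , _ , γ , γ∈Γ , domXγ , domSγ , res) =
      (actUR (u j , r₀) (inv γ) , inv γ , (inv-closed Γ γ∈Γ , stable-inv γ γ-stable) , refl)
    , Extends-resp (actPA-inv S γ) (actPA-inv X γ) (Extends-act (inv γ) extγ)
    where
      γ-stable : actSub (Uset i) γ ≐ Uset i
      γ-stable = ≐-trans (actSub-cong γ (≐-sym normS)) (≐-trans (≐-sym (dom-actPA S γ)) domSγ)
      extension : ∃[ r ] Extends (actPA S γ) (u j , r) (actPA X γ)
      extension = restricts⇒extends domSγ uj∉Ui (≐-trans domXγ Uset-suc) res
      r₀ : Fin m
      r₀ = proj₁ extension
      extγ : Extends (actPA S γ) (u j , r₀) (actPA X γ)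
      extγ = proj₂ extension

  point⇒e : (p : OrbTimesR j) → Σ (eSet i S) (λ X → Extends S (proj₁ p) (proj₁ X))
  point⇒e (p@(_ , _) , δ , (δ∈Γ , δ-stable) , refl) =
    (X , (δ , δ∈Γ , domX) , (inv δ , inv-closed Γ δ∈Γ , domXδ⁻¹ , domSδ⁻¹ , res)) , ext
    where
      X : PA {n} {m}
      X = insertAt S p
      ext : Extends S p X
      ext = insertAt-extends S p
      back : π δ ⟨$⟩ˡ (π δ ⟨$⟩ʳ u j) ≡ u j
      back = inverseˡ (π δ)
      domX : dom X ≐ actSub (Uset (suc i)) δ
      domX = ≐-trans (Extends-dom ext)
            (≐-trans (Insert-cong (≐-trans normS (≐-sym δ-stable)) refl)
            (≐-trans (≐-sym (actSub-Insert (Uset i) (u j) δ))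
                     (actSub-cong δ (≐-sym Uset-suc))))
      domSδ⁻¹ : dom (actPA S (inv δ)) ≐ Uset i
      domSδ⁻¹ = ≐-trans (dom-actPA S (inv δ))
                (≐-trans (actSub-cong (inv δ) normS) (stable-inv δ δ-stable))
      extδ⁻¹ : Extends (actPA S (inv δ)) (actUR p (inv δ)) (actPA X (inv δ))
      extδ⁻¹ = Extends-act (inv δ) ext
      domXδ⁻¹ : dom (actPA X (inv δ)) ≐ Uset (suc i)
      domXδ⁻¹ = ≐-trans (Extends-dom extδ⁻¹)
                (≐-trans (Insert-cong domSδ⁻¹ back) (≐-sym Uset-suc))
      res : RestrictEq (actPA X (inv δ)) (Uset i) (actPA S (inv δ))
      res = extends⇒restricts domSδ⁻¹ (uj∉Ui ∘ subst (Uset i) back) extδ⁻¹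

  newPoint : eSet i S → OrbTimesR j
  newPoint X = proj₁ (e⇒point X)

  Extends-aut : {X : PA {n} {m}} {p : Fin n × Fin m} {λ′ : Wr n m}
    → AutPA S λ′ → Extends S p X → Extends S (actUR p λ′) (actPA X λ′)
  Extends-aut {λ′ = λ′} (_ , λ′-fixes-S) ext =
    Extends-resp λ′-fixes-S (λ _ → refl) (Extends-act λ′ ext)

  -- The new point of X^λ is (new point of X)^λ, so Aut(S)-related X, Y have
  -- Aut(S)-related new points.
  newPoint-preserves : (X Y : eSet i S)
    → OrbRelPA (AutPA S) (proj₁ X) (proj₁ Y)
    → OrbRelUR (AutPA S) (proj₁ (newPoint X)) (proj₁ (newPoint Y))
  newPoint-preserves X Y (λ′ , λ′∈Aut , Xλ≗Y) =
    λ′ , λ′∈Aut , Extends-point-unique (point-fresh (newPoint Y))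
                    (Extends-resp (λ _ → refl) Xλ≗Y (Extends-aut λ′∈Aut (proj₂ (e⇒point X))))
                    (proj₂ (e⇒point Y))

  -- Conversely, if λ ∈ Aut(S) maps the new point of X to that of Y, then X^λ
  -- and Y extend S by the same point, hence coincide.
  newPoint-reflects : (X Y : eSet i S)
    → OrbRelUR (AutPA S) (proj₁ (newPoint X)) (proj₁ (newPoint Y))
    → OrbRelPA (AutPA S) (proj₁ X) (proj₁ Y)
  newPoint-reflects X Y (λ′ , λ′∈Aut , pλ≡q) =
    λ′ , λ′∈Aut , Extends-unique (subst (λ q → Extends S q (actPA (proj₁ X) λ′)) pλ≡q
                                       (Extends-aut λ′∈Aut (proj₂ (e⇒point X))))
                                 (proj₂ (e⇒point Y))

  newPoint-onto : (p : OrbTimesR j) → ∃[ X ] OrbRelUR (AutPA S) (proj₁ (newPoint X)) (proj₁ p)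
  newPoint-onto p =
    X , e₁ , (e∈Γ Γ , λ w → map-id (S w)) ,
    Extends-point-unique (point-fresh p) (proj₂ (e⇒point X)) (proj₂ (point⇒e p))
    where
      X : eSet i S
      X = proj₁ (point⇒e p)

lemma5p4 : {n m k : ℕ} (Γ : Subgroup n m) (u : Fin k → Fin n)
    → Injective _≡_ _≡_ u
    → (j : Fin k)
    → let open Setting Γ u in
    (S : PA {n} {m}) → Ω (toℕ j) S → Normalized (toℕ j) S
    → ClassBijection {eSet (toℕ j) S} {OrbTimesR j}
    (λ X Y → OrbRelPA (AutPA S) (proj₁ X) (proj₁ Y))
    (λ p q → OrbRelUR (AutPA S) (proj₁ p) (proj₁ q))
lemma5p4 Γ u u-inj j S _ normS =
    newPoint
  , (λ X Y → mk⇔ (newPoint-preserves X Y) (newPoint-reflects X Y))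
  , newPoint-onto
  where open Correspondence Γ u u-inj j S normS
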